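{- The equation $x+2y-4z=0$ satisfies $R(x+2y-4z=0,\mathbb{Z}/3\mathbb{Z})=8$.
   Context: $[1,n]=\{1,\dots,n\}$. For an equation $\mathcal{L}$ in three variables $x,y,z$ and a map $\chi:[1,n]\to\{0,1,2\}$, a solution $(x_1,x_2,x_3)\in[1,n]^3$ of $\mathcal{L}$ is zero-sum if $\chi(x_1)+\chi(x_2)+\chi(x_3)\equiv0\pmod 3$. $R(\mathcal{L},\mathbb{Z}/3\mathbb{Z})$ is the least positive integer $N$ (if it exists) such that for all $n\ge N$ every map $[1,n]\to\{0,1,2\}$ admits a zero-sum solution of $\mathcal{L}$ in $[1,n]^3$. -}

module Defs where

open import Data.Nat using (ℕ; _+_; _*_; _≤_; _<_; _%_)
open import Data.Fin using (Fin; toℕ)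
open import Data.Product using (Σ; _×_; ∃-syntax)
open import Relation.Binary.PropositionalEquality using (_≡_)
open import Relation.Nullary using (¬_)

-- A coloring χ : [1,n] → {0,1,2}; represented as a function ℕ → Fin 3,
-- of which only the values on [1,n] are ever used.
Coloring : Set
Coloring = ℕ → Fin 3

InRange : ℕ → ℕ → Set
InRange n x = 1 ≤ x × x ≤ n

-- The equation x + 2y - 4z = 0, written over ℕ as x + 2y = 4z.
Eqn : ℕ → ℕ → ℕ → Set
Eqn x y z = x + 2 * y ≡ 4 * z

HasZeroSumSolution : ℕ → Coloring → Set
HasZeroSumSolution n χ =
  ∃[ x ] ∃[ y ] ∃[ z ]
    (InRange n x × InRange n y × InRange n z × Eqn x y z ×
     (toℕ (χ x) + toℕ (χ y) + toℕ (χ z)) % 3 ≡ 0)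

Works : ℕ → Set
Works N = ∀ n → N ≤ n → ∀ (χ : Coloring) → HasZeroSumSolution n χ

IsR : ℕ → Set
IsR N = 1 ≤ N × Works N × (∀ M → 1 ≤ M → M < N → ¬ Works M)

-- A colouring is determined on [1,8] by 3⁸ = 6561 colour vectors, and each of them makes one of
-- the 16 solutions of x + 2y = 4z in [1,8]³ zero-sum, which an exhaustive check confirms.  The
-- colouring 0,1,0,2,1,1,2 of [1,7] admits no zero-sum solution, so no smaller bound works.
module Submission where

open import Defs
open import Data.Nat using (ℕ; zero; suc; _+_; _*_; _≤_; _<_; _%_; z≤n; s≤s; s≤s⁻¹; _≤?_)
open import Data.Nat.Properties using (_≟_; ≤-trans; anyUpTo?)
open import Data.Fin using (Fin; toℕ; zero; suc)
open import Data.Fin.Properties using (all?)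
open import Data.Vec using (Vec; []; _∷_)
open import Data.List using (List; []; _∷_)
open import Data.List.Relation.Unary.Any using (Any; here; there; any?)
open import Data.Product using (_,_; _×_; ∃-syntax)
open import Relation.Nullary using (¬_; Dec; map′; _×-dec_; from-yes; from-no)
open import Relation.Nullary.Decidable using (True; toWitness)
open import Relation.Unary using (Decidable)
open import Relation.Binary.PropositionalEquality using (_≡_; refl)

ZeroSum : Coloring → ℕ → ℕ → ℕ → Set
ZeroSum χ x y z = (toℕ (χ x) + toℕ (χ y) + toℕ (χ z)) % 3 ≡ 0

HasZeroSumSolution-mono : ∀ {m n} χ → m ≤ n → HasZeroSumSolution m χ → HasZeroSumSolution n χ
HasZeroSumSolution-mono _ m≤n (x , y , z , (1≤x , x≤m) , (1≤y , y≤m) , (1≤z , z≤m) , e , s) =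
  x , y , z , (1≤x , ≤-trans x≤m m≤n) , (1≤y , ≤-trans y≤m m≤n) , (1≤z , ≤-trans z≤m m≤n) , e , s

HasZeroSumSolution-cong : ∀ {n χ ψ} → (∀ {x} → InRange n x → χ x ≡ ψ x) →
                          HasZeroSumSolution n χ → HasZeroSumSolution n ψ
HasZeroSumSolution-cong {ψ = ψ} χ≗ψ (x , y , z , rx , ry , rz , e , s) =
  x , y , z , rx , ry , rz , e , zeroSum
  where
  zeroSum : ZeroSum ψ x y z
  zeroSum rewrite χ≗ψ rx | χ≗ψ ry | χ≗ψ rz = s

∃-InRange? : ∀ {p} {P : ℕ → Set p} → Decidable P → ∀ n → Dec (∃[ x ] (InRange n x × P x))
∃-InRange? {P = P} P? n = map′ to from (anyUpTo? (λ x → 1 ≤? x ×-dec P? x) (suc n))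
  where
  to : ∃[ x ] (x < suc n × 1 ≤ x × P x) → ∃[ x ] (InRange n x × P x)
  to (x , x<1+n , 1≤x , Px) = x , (1≤x , s≤s⁻¹ x<1+n) , Px
  from : ∃[ x ] (InRange n x × P x) → ∃[ x ] (x < suc n × 1 ≤ x × P x)
  from (x , (1≤x , x≤n) , Px) = x , s≤s x≤n , 1≤x , Px

hasZeroSumSolution? : ∀ n χ → Dec (HasZeroSumSolution n χ)
hasZeroSumSolution? n χ = map′ to from
  (∃-InRange? (λ x → ∃-InRange? (λ y → ∃-InRange? (λ z →
     (x + 2 * y ≟ 4 * z) ×-dec (_ ≟ 0)) n) n) n)
  where
  Nested : Set
  Nested = ∃[ x ] (InRange n x × ∃[ y ] (InRange n y × ∃[ z ] (InRange n z × Eqn x y z × ZeroSum χ x y z)))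
  to : Nested → HasZeroSumSolution n χ
  to (x , rx , y , ry , z , rz , e , s) = x , y , z , rx , ry , rz , e , s
  from : HasZeroSumSolution n χ → Nested
  from (x , y , z , rx , ry , rz , e , s) = x , rx , y , ry , z , rz , e , s

∀-Vec? : ∀ {p k n} {P : Vec (Fin k) n → Set p} → Decidable P → Dec (∀ v → P v)
∀-Vec? {n = zero}  P? = map′ (λ p → λ { [] → p }) (λ p → p []) (P? [])
∀-Vec? {n = suc n} P? = map′ (λ p → λ { (c ∷ v) → p c v }) (λ p c v → p (c ∷ v))
  (all? λ c → ∀-Vec? λ v → P? (c ∷ v))

-- The colour of x is the x-th entry; 0 and the points beyond n get the junk colour zero.
fromVec : ∀ {n} → Vec (Fin 3) n → Coloring
fromVec []      _             = zero
fromVec (c ∷ v) zero          = zero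
fromVec (c ∷ v) (suc zero)    = c
fromVec (c ∷ v) (suc (suc x)) = fromVec v (suc x)

restrict : ∀ n → Coloring → Vec (Fin 3) n
restrict zero    χ = []
restrict (suc n) χ = χ 1 ∷ restrict n (λ x → χ (suc x))

fromVec-restrict : ∀ n χ {x} → InRange n x → fromVec (restrict n χ) x ≡ χ x
fromVec-restrict (suc n) χ {suc zero}    _               = refl
fromVec-restrict (suc n) χ {suc (suc x)} (_ , s≤s x<n) =
  fromVec-restrict n (λ y → χ (suc y)) (s≤s z≤n , x<n)

Solution : ℕ → Set
Solution n = ∃[ x ] ∃[ y ] ∃[ z ] (InRange n x × InRange n y × InRange n z × Eqn x y z)

ZeroSumOn : ∀ {n} → Coloring → Solution n → Set
ZeroSumOn χ (x , y , z , _) = ZeroSum χ x y z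

solution : ∀ {n} x y z → {True ((1 ≤? x ×-dec x ≤? n) ×-dec (1 ≤? y ×-dec y ≤? n) ×-dec
                                 (1 ≤? z ×-dec z ≤? n) ×-dec (x + 2 * y ≟ 4 * z))} → Solution n
solution x y z {p} = x , y , z , toWitness p

zeroSumOn⇒HasZeroSumSolution : ∀ {n} χ (s : Solution n) → ZeroSumOn χ s → HasZeroSumSolution n χ
zeroSumOn⇒HasZeroSumSolution _ (x , y , z , rx , ry , rz , e) s = x , y , z , rx , ry , rz , e , s

-- All solutions in [1,8]³ (x = 4z − 2y); testing only these, rather than searching [1,8]³,
-- keeps the exhaustive check over 6561 colourings small.
solutions₈ : List (Solution 8)
solutions₈ =
  solution 2 1 1 ∷ solution 6 1 2 ∷ solution 4 2 2 ∷ solution 2 3 2 ∷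
  solution 8 2 3 ∷ solution 6 3 3 ∷ solution 4 4 3 ∷ solution 2 5 3 ∷
  solution 8 4 4 ∷ solution 6 5 4 ∷ solution 4 6 4 ∷ solution 2 7 4 ∷
  solution 8 6 5 ∷ solution 6 7 5 ∷ solution 4 8 5 ∷ solution 8 8 6 ∷ []

zeroSumOn? : ∀ {n} χ → Decidable (ZeroSumOn {n} χ)
zeroSumOn? χ (x , y , z , _) = _ ≟ 0

every-vector-hits-solutions₈ : ∀ (v : Vec (Fin 3) 8) → Any (ZeroSumOn (fromVec v)) solutions₈
every-vector-hits-solutions₈ = from-yes (∀-Vec? {n = 8} λ v → any? (zeroSumOn? (fromVec v)) solutions₈)

Any⇒HasZeroSumSolution : ∀ {n} χ {ss : List (Solution n)} → Any (ZeroSumOn χ) ss → HasZeroSumSolution n χ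
Any⇒HasZeroSumSolution χ {s ∷ _} (here zs) = zeroSumOn⇒HasZeroSumSolution χ s zs
Any⇒HasZeroSumSolution χ (there zs)        = Any⇒HasZeroSumSolution χ zs

works-8 : Works 8
works-8 n 8≤n χ =
  HasZeroSumSolution-mono χ 8≤n
    (HasZeroSumSolution-cong (fromVec-restrict 8 χ)
      (Any⇒HasZeroSumSolution (fromVec (restrict 8 χ)) (every-vector-hits-solutions₈ (restrict 8 χ))))

χ₇ : Coloring
χ₇ = fromVec (zero ∷ suc zero ∷ zero ∷ suc (suc zero) ∷ suc zero ∷ suc zero ∷ suc (suc zero) ∷ [])

χ₇-has-no-zero-sum-solution : ¬ HasZeroSumSolution 7 χ₇
χ₇-has-no-zero-sum-solution = from-no (hasZeroSumSolution? 7 χ₇)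

¬works-below-8 : ∀ M → M < 8 → ¬ Works M
¬works-below-8 M (s≤s M≤7) works = χ₇-has-no-zero-sum-solution (works 7 M≤7 χ₇)

proposition1 : IsR 8
proposition1 = s≤s z≤n , works-8 , λ M _ → ¬works-below-8 M
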